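{- Let $t \ge 3$ and $n \ge 1$ be integers. Then $M_t(K_n)$ is not a distance magic graph.
   Context: $K_n$ is the complete graph on $n$ vertices. For a graph $G=(V,E)$ and an integer $t \ge 1$, the generalised Mycielskian $M_t(G)$ is the graph with vertex set $(V \times \{0,1,\dots,t-1\}) \cup \{u\}$ (where $u$ is a new vertex), whose edges are: $(x,0)(y,0)$ for every edge $xy \in E$; $(x,i)(y,i+1)$ for every $0 \le i \le t-2$ and every ordered pair $(x,y)$ with $xy \in E$; and $(x,t-1)u$ for every $x \in V$. A graph $H$ on $N$ vertices is distance magic if there is a bijection $f: V(H) \to \{1,2,\dots,N\}$ and a constant $k$ such that for every vertex $v$, $\sum_{w \in N(v)} f(w) = k$, where $N(v)$ is the open neighbourhood of $v$. -}

module Defs where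

open import Data.Nat using (ℕ; zero; suc; _+_; _*_)
open import Data.Bool using (Bool; true; false; not; _∧_; _∨_; if_then_else_)
open import Data.Fin using (Fin; toℕ)
import Data.Fin as F
open import Data.Product using (_×_; _,_; ∃; Σ)
open import Data.Sum using (_⊎_; inj₁; inj₂)
open import Data.Unit using (⊤; tt)
open import Data.Nat using (_≡ᵇ_)
open import Function.Bundles using (_⤖_; Bijection)
open import Relation.Binary.PropositionalEquality using (_≡_)

sumFin : (n : ℕ) → (Fin n → ℕ) → ℕ
sumFin zero    g = 0
sumFin (suc n) g = g F.zero + sumFin n (λ i → g (F.suc i))

record FinGraph : Set₁ where
  field
    V     : Set
    order : ℕ
    sumV  : (V → ℕ) → ℕ
    adj   : V → V → Bool

open FinGraph public

[_] : Bool → ℕ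
[ true ]  = 1
[ false ] = 0

-- Distance magic: a bijection f : V → {1,…,N} (encoded as Fin N, label toℕ+1)
-- and a constant k with  Σ_{w ∈ N(v)} f(w) = k  for every vertex v.
DistanceMagic : FinGraph → Set
DistanceMagic G =
  Σ (V G ⤖ Fin (order G)) λ f →
    ∃ λ (k : ℕ) → ∀ (v : V G) →
      sumV G (λ w → [ adj G v w ] * suc (toℕ (Bijection.to f w))) ≡ k

completeAdj : (n : ℕ) → Fin n → Fin n → Bool
completeAdj n x y = not (toℕ x ≡ᵇ toℕ y)

MVert : ℕ → ℕ → Set
MVert n t = (Fin n × Fin t) ⊎ ⊤

sumMVert : (n t : ℕ) → (MVert n t → ℕ) → ℕ
sumMVert n t g =
  sumFin n (λ x → sumFin t (λ i → g (inj₁ (x , i)))) + g (inj₂ tt)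

mycAdj : (n t : ℕ) → (Fin n → Fin n → Bool) → MVert n t → MVert n t → Bool
mycAdj n t a (inj₁ (x , i)) (inj₁ (y , j)) =
  a x y ∧ (((toℕ i ≡ᵇ 0) ∧ (toℕ j ≡ᵇ 0))
          ∨ (suc (toℕ i) ≡ᵇ toℕ j) ∨ (suc (toℕ j) ≡ᵇ toℕ i))
mycAdj n t a (inj₁ (x , i)) (inj₂ tt) = suc (toℕ i) ≡ᵇ t
mycAdj n t a (inj₂ tt) (inj₁ (y , j)) = suc (toℕ j) ≡ᵇ t
mycAdj n t a (inj₂ tt) (inj₂ tt) = false

Mycielskian : (n t : ℕ) → (Fin n → Fin n → Bool) → FinGraph
Mycielskian n t a = record
  { V = MVert n t ; order = n * t + 1 ; sumV = sumMVert n t ; adj = mycAdj n t a }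

MycK : (t n : ℕ) → FinGraph
MycK t n = Mycielskian n t (completeAdj n)

-- Labels are positive. For n = 1 the vertex (0,0) of M_t(K_1) is isolated,
-- so the magic constant is 0, while the apex u has a neighbour. For n ≥ 2 the
-- neighbourhood of a top-layer vertex (x,t-1) is {u} together with the layer
-- t-2 minus (x,t-2); so its weight plus f(x,t-2) does not depend on x, and
-- two such vertices with equal weights force f(0,t-2) = f(1,t-2).
module Submission where

open import Defs
import Data.Nat.Properties
open import Algebra.Properties.Monoid.Sum Data.Nat.Properties.+-0-monoid
  using (sum; sum-cong-≗)
open import Data.Bool using (Bool; true; false; not; _∧_)
open import Data.Fin using (Fin; toℕ; fromℕ; inject₁)
import Data.Fin as F
open import Data.Fin.Patterns using (0F; 1F)
open import Data.Fin.Properties using (toℕ-injective; toℕ-fromℕ; toℕ-inject₁)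
open import Data.Nat using (ℕ; zero; suc; _+_; _*_; _≡ᵇ_; _≤_; s≤s)
open import Data.Nat.Properties
  using (+-identityʳ; +-assoc; +-comm; +-cancelˡ-≡; m+n≡0⇒m≡0; suc-injective; 0≢1+n)
open import Algebra.Properties.CommutativeSemigroup Data.Nat.Properties.+-commutativeSemigroup
  using (xy∙z≈xz∙y)
open import Data.Product using (_,_)
open import Data.Sum using (inj₁; inj₂)
open import Data.Unit using (tt)
open import Function using (_∘_)
open import Function.Bundles using (_⤖_; Bijection)
open import Relation.Binary.PropositionalEquality hiding ([_])
open import Relation.Nullary using (¬_)

sumFin≡sum : ∀ n (g : Fin n → ℕ) → sumFin n g ≡ sum g
sumFin≡sum zero    g = refl
sumFin≡sum (suc n) g = cong (g F.zero +_) (sumFin≡sum n (g ∘ F.suc))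

sumFin-cong : ∀ n {g h : Fin n → ℕ} → g ≗ h → sumFin n g ≡ sumFin n h
sumFin-cong n {g} {h} g≗h = begin
  sumFin n g  ≡⟨ sumFin≡sum n g ⟩
  sum g       ≡⟨ sum-cong-≗ g≗h ⟩
  sum h       ≡⟨ sumFin≡sum n h ⟨
  sumFin n h  ∎
  where open ≡-Reasoning

sumFin-zero : ∀ n → sumFin n (λ _ → 0) ≡ 0
sumFin-zero zero    = refl
sumFin-zero (suc n) = sumFin-zero n

sumFin-point : ∀ {n} (h : Fin n → ℕ) (i : Fin n) {m} → toℕ i ≡ m →
               sumFin n (λ j → [ toℕ j ≡ᵇ m ] * h j) ≡ h i
sumFin-point {suc n} h F.zero    refl =
  trans (cong₂ _+_ (+-identityʳ (h F.zero)) (sumFin-zero n)) (+-identityʳ (h F.zero))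
sumFin-point {suc n} h (F.suc i) refl = sumFin-point (h ∘ F.suc) i refl

sumFin-∧-point : ∀ {n} b (h : Fin n → ℕ) (i : Fin n) {m} → toℕ i ≡ m →
                 sumFin n (λ j → [ b ∧ (toℕ j ≡ᵇ m) ] * h j) ≡ [ b ] * h i
sumFin-∧-point       true  h i eq = trans (sumFin-point h i eq) (sym (+-identityʳ (h i)))
sumFin-∧-point {n} false h i eq = sumFin-zero n

sumFin-punctured : ∀ {n} (h : Fin n → ℕ) (i : Fin n) →
                   sumFin n (λ j → [ not (toℕ i ≡ᵇ toℕ j) ] * h j) + h i ≡ sumFin n h
sumFin-punctured {suc n} h F.zero = begin
  sumFin n (λ j → h (F.suc j) + 0) + h F.zero
    ≡⟨ cong (_+ h F.zero) (sumFin-cong n (+-identityʳ ∘ h ∘ F.suc)) ⟩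
  sumFin n (h ∘ F.suc) + h F.zero
    ≡⟨ +-comm _ (h F.zero) ⟩
  sumFin (suc n) h  ∎
  where open ≡-Reasoning
sumFin-punctured {suc n} h (F.suc i) = begin
  (h F.zero + 0) + Rest + h (F.suc i)  ≡⟨ cong (λ a → a + Rest + h (F.suc i)) (+-identityʳ _) ⟩
  h F.zero + Rest + h (F.suc i)        ≡⟨ +-assoc (h F.zero) Rest _ ⟩
  h F.zero + (Rest + h (F.suc i))      ≡⟨ cong (h F.zero +_) (sumFin-punctured (h ∘ F.suc) i) ⟩
  sumFin (suc n) h                     ∎
  where
  open ≡-Reasoning
  Rest : ℕ
  Rest = sumFin n (λ j → [ not (toℕ i ≡ᵇ toℕ j) ] * h (F.suc j))

weight : (G : FinGraph) → (V G → ℕ) → V G → ℕ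
weight G L v = sumV G (λ w → [ adj G v w ] * L w)

label : (G : FinGraph) → V G ⤖ Fin (order G) → V G → ℕ
label G f v = suc (toℕ (Bijection.to f v))

label-injective : ∀ {G} (f : V G ⤖ Fin (order G)) {v w} → label G f v ≡ label G f w → v ≡ w
label-injective f = Bijection.injective f ∘ toℕ-injective ∘ suc-injective

magic-cancel : ∀ {G} ((f , k , magic) : DistanceMagic G) (v a w b : V G) →
               weight G (label G f) v + label G f a ≡ weight G (label G f) w + label G f b →
               a ≡ b
magic-cancel {G} (f , k , magic) v a w b eq = label-injective {G} f (+-cancelˡ-≡ k _ _ (begin
  k + label G f a                      ≡⟨ cong (_+ label G f a) (magic v) ⟨
  weight G (label G f) v + label G f a ≡⟨ eq ⟩
  weight G (label G f) w + label G f b ≡⟨ cong (_+ label G f b) (magic w) ⟩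
  k + label G f b                      ∎))
  where open ≡-Reasoning

≡ᵇ-refl : ∀ m → (m ≡ᵇ m) ≡ true
≡ᵇ-refl zero    = refl
≡ᵇ-refl (suc m) = ≡ᵇ-refl m

≡ᵇ-toℕ-bound : ∀ k (j : Fin k) → (k ≡ᵇ toℕ j) ≡ false
≡ᵇ-toℕ-bound (suc k) F.zero    = refl
≡ᵇ-toℕ-bound (suc k) (F.suc j) = ≡ᵇ-toℕ-bound k j

top penultimate : ∀ {m} → Fin (suc (suc m))
top         {m} = fromℕ (suc m)
penultimate {m} = inject₁ (fromℕ m)

toℕ-penultimate : ∀ m → toℕ (penultimate {m}) ≡ m
toℕ-penultimate m = trans (toℕ-inject₁ (fromℕ m)) (toℕ-fromℕ m)

module _ {n m : ℕ} (a : Fin n → Fin n → Bool) where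

  top-adj : ∀ x y j → mycAdj n (suc (suc m)) a (inj₁ (x , top)) (inj₁ (y , j)) ≡ a x y ∧ (toℕ j ≡ᵇ m)
  top-adj x y j rewrite toℕ-fromℕ m | ≡ᵇ-toℕ-bound (suc (suc m)) j = refl

  top-adj-apex : ∀ x → mycAdj n (suc (suc m)) a (inj₁ (x , top)) (inj₂ tt) ≡ true
  top-adj-apex x = trans (cong (_≡ᵇ suc m) (toℕ-fromℕ (suc m))) (≡ᵇ-refl m)

  top-weight : ∀ L x → weight (Mycielskian n (suc (suc m)) a) L (inj₁ (x , top)) ≡
               sumFin n (λ y → [ a x y ] * L (inj₁ (y , penultimate))) + L (inj₂ tt)
  top-weight L x = cong₂ _+_
    (sumFin-cong n λ y → trans
      (sumFin-cong (suc (suc m)) λ j → cong (λ b → [ b ] * L (inj₁ (y , j))) (top-adj x y j))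
      (sumFin-∧-point (a x y) (λ j → L (inj₁ (y , j))) penultimate (toℕ-penultimate m)))
    (trans (cong (λ b → [ b ] * L (inj₂ tt)) (top-adj-apex x)) (+-identityʳ (L (inj₂ tt))))

  isolated-base-weight : ∀ L x → (∀ y → a x y ≡ false) →
                         weight (Mycielskian n (suc (suc m)) a) L (inj₁ (x , F.zero)) ≡ 0
  isolated-base-weight L x isolated = trans (+-identityʳ _) (trans
    (sumFin-cong n λ y → trans (sumFin-cong (suc (suc m)) (no-edge y)) (sumFin-zero (suc (suc m))))
    (sumFin-zero n))
    where
    no-edge : ∀ y j → [ mycAdj n (suc (suc m)) a (inj₁ (x , F.zero)) (inj₁ (y , j)) ] * L (inj₁ (y , j)) ≡ 0
    no-edge y j rewrite isolated y = refl

apex-weight-nonzero : ∀ {n m} a (h : MVert (suc n) (suc m) → ℕ) →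
                      ¬ weight (Mycielskian (suc n) (suc m) a) (suc ∘ h) (inj₂ tt) ≡ 0
apex-weight-nonzero {n} {m} a h weight≡0 = 0≢1+n (trans (sym firstColumn≡0) lastLabel)
  where
  firstColumn : ℕ
  firstColumn = sumFin (suc m) (λ j → [ toℕ j ≡ᵇ m ] * suc (h (inj₁ (F.zero , j))))
  firstColumn≡0 : firstColumn ≡ 0
  firstColumn≡0 = m+n≡0⇒m≡0 firstColumn (m+n≡0⇒m≡0 _ weight≡0)
  lastLabel : firstColumn ≡ suc (h (inj₁ (F.zero , fromℕ m)))
  lastLabel = sumFin-point (λ j → suc (h (inj₁ (F.zero , j)))) (fromℕ m) (toℕ-fromℕ m)

MycK-top-weight-+ : ∀ {n m} (L : MVert n (suc (suc m)) → ℕ) x →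
                    weight (MycK (suc (suc m)) n) L (inj₁ (x , top)) + L (inj₁ (x , penultimate)) ≡
                    sumFin n (λ y → L (inj₁ (y , penultimate))) + L (inj₂ tt)
MycK-top-weight-+ {n} L x = begin
  weight (MycK _ n) L (inj₁ (x , top)) + L (inj₁ (x , penultimate))
    ≡⟨ cong (_+ L (inj₁ (x , penultimate))) (top-weight (completeAdj n) L x) ⟩
  Others + L (inj₂ tt) + L (inj₁ (x , penultimate))
    ≡⟨ xy∙z≈xz∙y Others _ _ ⟩
  Others + L (inj₁ (x , penultimate)) + L (inj₂ tt)
    ≡⟨ cong (_+ L (inj₂ tt)) (sumFin-punctured (λ y → L (inj₁ (y , penultimate))) x) ⟩
  sumFin n (λ y → L (inj₁ (y , penultimate))) + L (inj₂ tt)  ∎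
  where
  open ≡-Reasoning
  Others : ℕ
  Others = sumFin n (λ y → [ completeAdj n x y ] * L (inj₁ (y , penultimate)))

MycK-notDistanceMagic : ∀ m n → 1 ≤ n → ¬ DistanceMagic (MycK (suc (suc m)) n)
MycK-notDistanceMagic m 1 _ (f , k , magic) =
  apex-weight-nonzero (completeAdj 1) (toℕ ∘ Bijection.to f) (begin
    weight G L (inj₂ tt)          ≡⟨ magic (inj₂ tt) ⟩
    k                             ≡⟨ magic (inj₁ (0F , 0F)) ⟨
    weight G L (inj₁ (0F , 0F))   ≡⟨ isolated-base-weight (completeAdj 1) L 0F (λ { 0F → refl }) ⟩
    0                             ∎)
  where
  open ≡-Reasoning
  G : FinGraph
  G = MycK (suc (suc m)) 1
  L : V G → ℕ
  L = label G f
MycK-notDistanceMagic m (suc (suc q)) _ dm@(f , _) =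
  distinct (magic-cancel {G} dm (inj₁ (0F , top)) (inj₁ (0F , penultimate))
                                (inj₁ (1F , top)) (inj₁ (1F , penultimate))
                                (trans (MycK-top-weight-+ L 0F) (sym (MycK-top-weight-+ L 1F))))
  where
  G : FinGraph
  G = MycK (suc (suc m)) (suc (suc q))
  L : V G → ℕ
  L = label G f
  distinct : ¬ inj₁ (0F , penultimate) ≡ inj₁ (1F , penultimate)
  distinct ()

corollary2p6 : (t n : ℕ) → 3 ≤ t → 1 ≤ n → ¬ DistanceMagic (MycK t n)
corollary2p6 (suc (suc t)) n (s≤s (s≤s _)) = MycK-notDistanceMagic t n
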